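{- Let $\pi\in\mathcal{S}_n$ be such that both $\pi$ and $\hat\pi=\theta(\pi)$ avoid $132$. If $\hat\pi_i=n$, then $i\in\{1,n-1,n\}$.
   Context: $\mathcal{S}_n$ is the symmetric group on $[n]$, permutations in one-line notation $\pi_1\cdots\pi_n$. A permutation avoids a pattern $\tau$ if it has no subsequence order-isomorphic to $\tau$. The standard cycle notation of $\pi$ writes each cycle (fixed points included) with its largest element first and orders cycles by increasing largest element. The fundamental bijection $\theta:\mathcal{S}_n\to\mathcal{S}_n$ maps $\pi$ to the permutation whose one-line notation is obtained by erasing the parentheses of the standard cycle notation of $\pi$. -}

module Defs where

open import Data.Nat using (ℕ; zero; suc; _<_; _∸_)
open import Data.Fin using (Fin; toℕ; _≟_)
open import Data.Fin.Permutation using (Permutation′; _⟨$⟩ʳ_)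
open import Data.List using (List; []; _∷_; map; allFin; concatMap; foldr; upTo)
open import Data.List.Relation.Binary.Sublist.Propositional using (_⊆_)
open import Data.Product using (∃; ∃-syntax; _×_)
open import Data.Bool using (Bool; true; false; if_then_else_; _∧_)
open import Relation.Nullary using (¬_)
open import Relation.Nullary.Decidable using (⌊_⌋)
open import Data.Nat.Properties using () renaming (_≤?_ to _≤ℕ?_)

-- Values of permutations are stored 1-based (a Fin n value i is the number toℕ i + 1).

oneLine : ∀ {n} → Permutation′ n → List ℕ
oneLine {n} π = map (λ i → suc (toℕ (π ⟨$⟩ʳ i))) (allFin n)

Contains132 : List ℕ → Set
Contains132 w = ∃[ a ] ∃[ b ] ∃[ c ] ((a ∷ b ∷ c ∷ []) ⊆ w × a < c × c < b)

Avoids132 : List ℕ → Set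
Avoids132 w = ¬ Contains132 w

iter : ∀ {n} → Permutation′ n → ℕ → Fin n → Fin n
iter π zero    x = x
iter π (suc k) x = π ⟨$⟩ʳ (iter π k x)

cycleRest : ∀ {n} → Permutation′ n → Fin n → ℕ → Fin n → List (Fin n)
cycleRest π m zero       x = []
cycleRest π m (suc fuel) x =
  if ⌊ x ≟ m ⌋ then [] else (x ∷ cycleRest π m fuel (π ⟨$⟩ʳ x))

cycleOf : ∀ {n} → Permutation′ n → Fin n → List (Fin n)
cycleOf {n} π m = m ∷ cycleRest π m n (π ⟨$⟩ʳ m)

isCycleMax : ∀ {n} → Permutation′ n → Fin n → Bool
isCycleMax {n} π m = foldr (λ k b → ⌊ toℕ (iter π k m) ≤ℕ? toℕ m ⌋ ∧ b) true (upTo n)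

-- Fundamental bijection θ: erase parentheses in the standard cycle notation
-- (each cycle starts with its largest element; cycles ordered by increasing largest element).
theta : ∀ {n} → Permutation′ n → List ℕ
theta {n} π =
  concatMap (λ m → if isCycleMax π m then map (λ x → suc (toℕ x)) (cycleOf π m) else [])
            (allFin n)

{-# OPTIONS --safe #-}
-- θ(π) lists the cycles whose maximum is below n, each written from its
-- maximum, and ends with the cycle (n c₁ … c_k) of n; so n stands at
-- position ℓ + 1, where ℓ = n − 1 − k is the total length of the lower cycles.
-- If θ(π) avoids 132, every c_j is smaller than every element of a lower
-- cycle (else p n c_j is a 132). Suppose ℓ > 0 and k ≥ 2, take t in a lower
-- cycle (so π(t) lies in one too) and let u = c_{k−1}, v = c_k, so π(u) = v
-- and π(v) = n. If v < c₁, the positions u < t < n carry the 132 v π(t) c₁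
-- in π; if v > c₁, the positions c₁ < v < t carry the 132 c₂ n π(t).
-- Hence ℓ = 0 or k ≤ 1.

module Submission where

open import Defs
open import Data.Nat using (ℕ; zero; suc; _+_; _∸_; z≤n; s≤s)
import Data.Nat as ℕ
open import Data.Nat.Properties
  using ( +-suc; +-comm; m≤n+m; m≤n⇒∃[o]m+o≡n; ≤-refl; ≤-trans; <-≤-trans; <⇒≤; <-irrefl; ≮⇒≥
        ; m≤n⇒m≤1+n; n<1+n; suc-injective)
open import Data.Fin using (Fin; toℕ; fromℕ; inject₁; _≤_; _<_)
import Data.Fin as Fin
open import Data.Fin.Properties
  using ( toℕ-injective; toℕ<n; toℕ-fromℕ; pigeonhole; ≤fromℕ; ≤∧≢⇒<; fromℕ≢inject₁; <-cmp
        ; ≤-antisym; ≤-totalOrder)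
open import Data.Fin.Permutation using (Permutation′; _⟨$⟩ʳ_)
open import Data.List using (List; []; _∷_; _++_; map; concatMap; tabulate; allFin; length; lookup; upTo)
open import Data.List.Properties
  using ( length-++; length-map; length-tabulate; map-++; ++-identityʳ; concatMap-++; concatMap-cong
        ; map-concatMap; foldr-map)
open import Data.List.Relation.Unary.Any using (here; there)
import Data.List.Relation.Unary.Any as Any
open import Data.List.Relation.Unary.Any.Properties using () renaming (tabulate⁻ to Any-tabulate⁻)
import Data.List.Relation.Unary.All as All
open import Data.List.Relation.Unary.All.Properties
  using (all⁺; all⁻; ¬Any⇒All¬) renaming (map⁺ to All-map⁺)
import Data.List.Relation.Unary.AllPairs as AllPairs
open import Data.List.Relation.Unary.AllPairs.Properties using () renaming (map⁺ to AllPairs-map⁺)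
open import Data.List.Relation.Unary.Unique.Propositional using (Unique)
open import Data.List.Relation.Unary.Unique.Propositional.Properties using (concat⁺; allFin⁺)
open import Data.List.Relation.Binary.Disjoint.Propositional using (Disjoint)
open import Data.List.Membership.Propositional using (_∈_; _∉_; lose)
open import Data.List.Membership.Propositional.Properties
  using (∈-map⁻; ∈-tabulate⁺; ∈-allFin; ∈-upTo⁺; ∈-lookup; ∈-concatMap⁺; ∈-concatMap⁻)
open import Data.List.Membership.Propositional.Properties.WithK using (unique∧set⇒bag)
open import Data.List.Relation.Binary.BagAndSetEquality using (∼bag⇒↭)
open import Data.List.Relation.Binary.Permutation.Propositional.Properties using (↭-length)
open import Data.List.Relation.Binary.Sublist.Propositional using (_⊆_; _∷_; _∷ʳ_; from∈)
open import Data.List.Relation.Binary.Sublist.Propositional.Properties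
  using (++⁺) renaming (map⁺ to ⊆-map⁺)
import Data.List.Extrema
open import Data.Bool using (Bool; true; false; T; if_then_else_)
open import Data.Bool.ListAction using (all)
open import Data.Bool.Properties using (T-≡; if-float)
open import Data.Product using (∃; ∃₂; _×_; _,_)
open import Data.Sum using (_⊎_; inj₁; inj₂; [_,_]′)
import Data.Sum as Sum
open import Data.Empty using (⊥-elim)
open import Function using (_∘_; id; _⇔_; mk⇔; Equivalence; Injection)
open import Function.Properties.Inverse using (↔⇒↣)
open import Relation.Nullary using (¬_; yes; no)
open import Relation.Nullary.Decidable using (⌊_⌋; toWitness; fromWitness)
open import Relation.Binary.Definitions using (tri<; tri≈; tri>)
open import Relation.Binary.PropositionalEquality
  using (_≡_; _≢_; refl; sym; trans; cong; subst; module ≡-Reasoning)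

private
  variable
    A : Set

oneBased : ∀ {n} → Fin n → ℕ
oneBased x = suc (toℕ x)

oneBased-∉-map : ∀ {n} {y : Fin n} {xs} → y ∉ xs → oneBased y ∉ map oneBased xs
oneBased-∉-map y∉xs y∈ with ∈-map⁻ oneBased y∈
... | x , x∈xs , e = y∉xs (subst (_∈ _) (sym (toℕ-injective (suc-injective e))) x∈xs)

tabulate-∷ʳ : ∀ {n} (f : Fin (suc n) → A) → tabulate f ≡ tabulate (f ∘ inject₁) ++ f (fromℕ n) ∷ []
tabulate-∷ʳ {n = zero}  f = refl
tabulate-∷ʳ {n = suc n} f = cong (f Fin.zero ∷_) (tabulate-∷ʳ (f ∘ Fin.suc))

tabulate-⊆₂ : ∀ {n} (f : Fin n → A) {i j} → i < j → (f i ∷ f j ∷ []) ⊆ tabulate f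
tabulate-⊆₂ f {Fin.zero}  {Fin.suc j} _         = refl ∷ from∈ (∈-tabulate⁺ j)
tabulate-⊆₂ f {Fin.suc i} {Fin.suc j} (s≤s i<j) = f Fin.zero ∷ʳ tabulate-⊆₂ (f ∘ Fin.suc) i<j

tabulate-⊆₃ : ∀ {n} (f : Fin n → A) {i j k} → i < j → j < k → (f i ∷ f j ∷ f k ∷ []) ⊆ tabulate f
tabulate-⊆₃ f {Fin.zero}  {Fin.suc j} {Fin.suc k} _         (s≤s j<k) =
  refl ∷ tabulate-⊆₂ (f ∘ Fin.suc) j<k
tabulate-⊆₃ f {Fin.suc i} {Fin.suc j} {Fin.suc k} (s≤s i<j) (s≤s j<k) =
  f Fin.zero ∷ʳ tabulate-⊆₃ (f ∘ Fin.suc) i<j j<k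

length-unique-enumeration : ∀ {n} {xs : List (Fin n)} → Unique xs → (∀ x → x ∈ xs) → length xs ≡ n
length-unique-enumeration {n} {xs} unique complete = begin
  length xs         ≡⟨ ↭-length (∼bag⇒↭ (unique∧set⇒bag unique (allFin⁺ n) xs≈allFin)) ⟩
  length (allFin n) ≡⟨ length-tabulate id ⟩
  n                 ∎
  where
  open ≡-Reasoning
  xs≈allFin : ∀ {x} → x ∈ xs ⇔ x ∈ allFin n
  xs≈allFin {x} = mk⇔ (λ _ → ∈-allFin x) (λ _ → complete x)

toℕ-lookup≡middle : ∀ {w xs ys : List A} {v} → w ≡ xs ++ v ∷ ys → v ∉ xs → v ∉ ys →
                    (i : Fin (length w)) → lookup w i ≡ v → toℕ i ≡ length xs
toℕ-lookup≡middle {xs = []}     refl _    _    Fin.zero    _ = refl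
toℕ-lookup≡middle {xs = []}     refl _    v∉ys (Fin.suc i) e = ⊥-elim (v∉ys (subst (_∈ _) e (∈-lookup i)))
toℕ-lookup≡middle {xs = _ ∷ _}  refl v∉xs _    Fin.zero    e = ⊥-elim (v∉xs (here (sym e)))
toℕ-lookup≡middle {xs = _ ∷ _}  refl v∉xs v∉ys (Fin.suc i) e =
  cong suc (toℕ-lookup≡middle refl (v∉xs ∘ there) v∉ys i e)

contains132-++ : ∀ {n} {a b c : Fin n} {xs ys} → a ∈ xs → c ∈ ys → a < c → c < b →
                 Contains132 (map oneBased (xs ++ b ∷ ys))
contains132-++ a∈xs c∈ys a<c c<b =
  _ , _ , _ , ⊆-map⁺ oneBased (++⁺ (from∈ a∈xs) (refl ∷ from∈ c∈ys)) , s≤s a<c , s≤s c<b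

oneLine-contains132 : ∀ {n} (π : Permutation′ n) {x y z} → x < y → y < z →
                      π ⟨$⟩ʳ x < π ⟨$⟩ʳ z → π ⟨$⟩ʳ z < π ⟨$⟩ʳ y → Contains132 (oneLine π)
oneLine-contains132 π x<y y<z πx<πz πz<πy =
  _ , _ , _ , ⊆-map⁺ (oneBased ∘ (π ⟨$⟩ʳ_)) (tabulate-⊆₃ id x<y y<z) , s≤s πx<πz , s≤s πz<πy

module _ {n} (π : Permutation′ n) where

  iter-suc : ∀ k x → iter π (suc k) x ≡ iter π k (π ⟨$⟩ʳ x)
  iter-suc zero    x = refl
  iter-suc (suc k) x = cong (π ⟨$⟩ʳ_) (iter-suc k x)

  iter-+ : ∀ a b x → iter π (a + b) x ≡ iter π a (iter π b x)
  iter-+ zero    b x = refl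
  iter-+ (suc a) b x = cong (π ⟨$⟩ʳ_) (iter-+ a b x)

  iter-injective : ∀ k {x y} → iter π k x ≡ iter π k y → x ≡ y
  iter-injective zero    e = e
  iter-injective (suc k) e = iter-injective k (Injection.injective (↔⇒↣ π) e)

  -- Pigeonhole on x, π x, …, πⁿ x, then cancel the common prefix of iterations.
  iter-returns : ∀ x → ∃ λ a → a ℕ.< n × iter π a (π ⟨$⟩ʳ x) ≡ x
  iter-returns x with pigeonhole (n<1+n n) (λ j → iter π (toℕ j) x)
  ... | i , j , i<j , πⁱx≡πʲx with m≤n⇒∃[o]m+o≡n i<j
  ... | a , i+1+a≡j = a , a<n , trans (sym (iter-suc a x)) (sym (iter-injective (toℕ i) πⁱx≡πⁱ⁺¹⁺ᵃx))
    where
    open ≡-Reasoning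
    a<n : a ℕ.< n
    a<n = ≤-trans (s≤s (m≤n+m a (toℕ i))) (subst (ℕ._≤ n) (sym i+1+a≡j) (ℕ.s≤s⁻¹ (toℕ<n j)))
    πⁱx≡πⁱ⁺¹⁺ᵃx : iter π (toℕ i) x ≡ iter π (toℕ i) (iter π (suc a) x)
    πⁱx≡πⁱ⁺¹⁺ᵃx = begin
      iter π (toℕ i) x                   ≡⟨ πⁱx≡πʲx ⟩
      iter π (toℕ j) x                   ≡⟨ cong (λ k → iter π k x) (trans (sym i+1+a≡j) (sym (+-suc (toℕ i) a))) ⟩
      iter π (toℕ i + suc a) x           ≡⟨ iter-+ (toℕ i) (suc a) x ⟩
      iter π (toℕ i) (iter π (suc a) x)  ∎

  data Path (m : Fin n) : Fin n → List (Fin n) → Set where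
    []  : Path m m []
    _∷_ : ∀ {x xs} → x ≢ m → Path m (π ⟨$⟩ʳ x) xs → Path m x (x ∷ xs)

  cycleRest-path : ∀ {m} fuel x a → a ℕ.≤ fuel → iter π a x ≡ m → Path m x (cycleRest π m fuel x)
  cycleRest-path zero x zero _ refl = []
  cycleRest-path {m} (suc fuel) x a a≤fuel πᵃx≡m with x Fin.≟ m
  ... | yes refl = []
  cycleRest-path (suc fuel) x zero    _            x≡m     | no x≢m = ⊥-elim (x≢m x≡m)
  cycleRest-path (suc fuel) x (suc a) (s≤s a≤fuel) πᵃ⁺¹x≡m | no x≢m =
    x≢m ∷ cycleRest-path fuel (π ⟨$⟩ʳ x) a a≤fuel (trans (sym (iter-suc a x)) πᵃ⁺¹x≡m)

  path-length≤ : ∀ {m x xs} a → Path m x xs → iter π a x ≡ m → length xs ℕ.≤ a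
  path-length≤ a       []         _   = z≤n
  path-length≤ zero    (x≢m ∷ _)  x≡m = ⊥-elim (x≢m x≡m)
  path-length≤ (suc a) (_ ∷ path) e   = s≤s (path-length≤ a path (trans (sym (iter-suc a _)) e))

  path-iter : ∀ {m x xs} → Path m x xs → iter π (length xs) x ≡ m
  path-iter []                                = refl
  path-iter {x = x} {xs = _ ∷ xs} (_ ∷ path) = trans (iter-suc (length xs) x) (path-iter path)

  path-∌ : ∀ {m x xs} → Path m x xs → m ∉ xs
  path-∌ (x≢m ∷ _)    (here refl) = x≢m refl
  path-∌ (_   ∷ path) (there m∈)  = path-∌ path m∈

  path-head : ∀ {m x xs} → Path m x xs → x ≡ m ⊎ x ∈ xs
  path-head []      = inj₁ refl
  path-head (_ ∷ _) = inj₂ (here refl)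

  path-next : ∀ {m x xs y} → Path m x xs → y ∈ xs → π ⟨$⟩ʳ y ≡ m ⊎ π ⟨$⟩ʳ y ∈ xs
  path-next (_ ∷ path) (here refl) = Sum.map₂ there (path-head path)
  path-next (_ ∷ path) (there y∈)  = Sum.map₂ there (path-next path y∈)

  ∈-path⁻ : ∀ {m x xs y} → Path m x xs → y ∈ xs → ∃ λ k → k ℕ.< length xs × iter π k x ≡ y
  ∈-path⁻ (_ ∷ _) (here refl) = 0 , s≤s z≤n , refl
  ∈-path⁻ {x = x} (_ ∷ path) (there y∈) with ∈-path⁻ path y∈
  ... | k , k<len , πᵏπx≡y = suc k , s≤s k<len , trans (iter-suc k x) πᵏπx≡y

  path-suffix : ∀ {m x xs y} → Path m x xs → y ∈ xs → ∃ λ ys → Path m y ys × length ys ℕ.≤ length xs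
  path-suffix path@(_ ∷ _) (here refl) = _ , path , ≤-refl
  path-suffix (_ ∷ path)   (there y∈) with path-suffix path y∈
  ... | ys , path′ , len≤ = ys , path′ , m≤n⇒m≤1+n len≤

  path-deterministic : ∀ {m x xs ys} → Path m x xs → Path m x ys → xs ≡ ys
  path-deterministic []         []          = refl
  path-deterministic []         (x≢m ∷ _)   = ⊥-elim (x≢m refl)
  path-deterministic (x≢m ∷ _)  []          = ⊥-elim (x≢m refl)
  path-deterministic (_ ∷ path) (_ ∷ path′) = cong (_ ∷_) (path-deterministic path path′)

  -- A repeated point would give a second, shorter path from it to m.
  path-unique : ∀ {m x xs} → Path m x xs → Unique xs
  path-unique []                         = AllPairs.[]
  path-unique {xs = x ∷ xs} (x≢m ∷ path) = ¬Any⇒All¬ xs x∉xs AllPairs.∷ path-unique path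
    where
    x∉xs : x ∉ xs
    x∉xs x∈xs with path-suffix path x∈xs
    ... | ys , path′ , len≤ = <-irrefl refl
      (subst (λ zs → length zs ℕ.≤ length xs) (path-deterministic path′ (x≢m ∷ path)) len≤)

  path-last-two : ∀ {m x a b cs} → Path m x (a ∷ b ∷ cs) →
                  ∃₂ λ u v → u ∈ a ∷ b ∷ cs × v ∈ a ∷ b ∷ cs × π ⟨$⟩ʳ u ≡ v × π ⟨$⟩ʳ v ≡ m
  path-last-two (_ ∷ (_ ∷ [])) = _ , _ , here refl , there (here refl) , refl , refl
  path-last-two (_ ∷ path@(_ ∷ (_ ∷ _))) with path-last-two path
  ... | u , v , u∈ , v∈ , πu≡v , πv≡m = u , v , there u∈ , there v∈ , πu≡v , πv≡m

  cycleTail : Fin n → List (Fin n)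
  cycleTail m = cycleRest π m n (π ⟨$⟩ʳ m)

  cycleTail-path : ∀ m → Path m (π ⟨$⟩ʳ m) (cycleTail m)
  cycleTail-path m with iter-returns m
  ... | a , a<n , πᵃπm≡m = cycleRest-path n (π ⟨$⟩ʳ m) a (<⇒≤ a<n) πᵃπm≡m

  length-cycleOf≤ : ∀ m → length (cycleOf π m) ℕ.≤ n
  length-cycleOf≤ m with iter-returns m
  ... | a , a<n , πᵃπm≡m = ≤-trans (s≤s (path-length≤ a (cycleTail-path m) πᵃπm≡m)) a<n

  cycleOf-unique : ∀ m → Unique (cycleOf π m)
  cycleOf-unique m = ¬Any⇒All¬ _ (path-∌ (cycleTail-path m)) AllPairs.∷ path-unique (cycleTail-path m)

  ∈-cycleOf⁻ : ∀ {m z} → z ∈ cycleOf π m → ∃ λ k → k ℕ.< n × iter π k m ≡ z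
  ∈-cycleOf⁻ {m} (here refl) = 0 , <-≤-trans (s≤s z≤n) (length-cycleOf≤ m) , refl
  ∈-cycleOf⁻ {m} (there z∈) with ∈-path⁻ (cycleTail-path m) z∈
  ... | k , k<len , πᵏπm≡z =
    suc k , <-≤-trans (s≤s k<len) (length-cycleOf≤ m) , trans (iter-suc k m) πᵏπm≡z

  next-∈-cycleOf : ∀ {m z} → z ∈ cycleOf π m → π ⟨$⟩ʳ z ∈ cycleOf π m
  next-∈-cycleOf {m} (here refl) = [ here , there ]′ (path-head (cycleTail-path m))
  next-∈-cycleOf {m} (there z∈)  = [ here , there ]′ (path-next (cycleTail-path m) z∈)

  iter-∈-cycleOf : ∀ {m z} → z ∈ cycleOf π m → ∀ k → iter π k z ∈ cycleOf π m
  iter-∈-cycleOf z∈ zero    = z∈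
  iter-∈-cycleOf z∈ (suc k) = next-∈-cycleOf (iter-∈-cycleOf z∈ k)

  ∈-cycleOf-sym : ∀ {m z} → z ∈ cycleOf π m → m ∈ cycleOf π z
  ∈-cycleOf-sym (here refl) = here refl
  ∈-cycleOf-sym {m} {z} (there z∈) with path-suffix (cycleTail-path m) z∈
  ... | zs , path , _ = subst (_∈ cycleOf π z) (path-iter path) (iter-∈-cycleOf (here refl) (length zs))

  ∈-cycleOf-trans : ∀ {m y z} → y ∈ cycleOf π m → z ∈ cycleOf π y → z ∈ cycleOf π m
  ∈-cycleOf-trans y∈ z∈ with ∈-cycleOf⁻ z∈
  ... | k , _ , πᵏy≡z = subst (_∈ _) πᵏy≡z (iter-∈-cycleOf y∈ k)

  IsCycleMax : Fin n → Set
  IsCycleMax m = ∀ {z} → z ∈ cycleOf π m → z ≤ m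

  iter≤ᵇ : Fin n → ℕ → Bool
  iter≤ᵇ m k = ⌊ toℕ (iter π k m) ℕ.≤? toℕ m ⌋

  isCycleMax≡all : ∀ m → isCycleMax π m ≡ all (iter≤ᵇ m) (upTo n)
  isCycleMax≡all m = sym (foldr-map _ _ true (upTo n))

  isCycleMax⇒IsCycleMax : ∀ {m} → T (isCycleMax π m) → IsCycleMax m
  isCycleMax⇒IsCycleMax {m} isMax z∈ with ∈-cycleOf⁻ z∈
  ... | k , k<n , refl =
    toWitness (All.lookup (all⁺ (iter≤ᵇ m) (upTo n) (subst T (isCycleMax≡all m) isMax)) (∈-upTo⁺ k<n))

  IsCycleMax⇒isCycleMax : ∀ {m} → IsCycleMax m → T (isCycleMax π m)
  IsCycleMax⇒isCycleMax {m} isMax = subst T (sym (isCycleMax≡all m))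
    (all⁻ (iter≤ᵇ m) {upTo n} (All.tabulate (λ {k} _ → fromWitness (isMax (iter-∈-cycleOf (here refl) k)))))

  cycleMax-exists : ∀ x → ∃ λ m → IsCycleMax m × x ∈ cycleOf π m
  cycleMax-exists x = m , m-isMax , ∈-cycleOf-sym m∈
    where
    open Data.List.Extrema (≤-totalOrder n) using (max; argmax-sel; ⊥≤max; xs≤max)
    m = max x (cycleTail x)
    m∈ : m ∈ cycleOf π x
    m∈ = [ here , there ]′ (argmax-sel id x (cycleTail x))
    bounded : ∀ {z} → z ∈ cycleOf π x → z ≤ m
    bounded (here refl) = ⊥≤max x (cycleTail x)
    bounded (there z∈)  = All.lookup (xs≤max x (cycleTail x)) z∈
    m-isMax : IsCycleMax m
    m-isMax z∈ = bounded (∈-cycleOf-trans m∈ z∈)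

  standardCycle : Fin n → List (Fin n)
  standardCycle m = if isCycleMax π m then cycleOf π m else []

  ∈-standardCycle⁻ : ∀ {m z} → z ∈ standardCycle m → IsCycleMax m × z ∈ cycleOf π m
  ∈-standardCycle⁻ {m} z∈ with isCycleMax π m in isMax
  ... | true = isCycleMax⇒IsCycleMax (subst T (sym isMax) _) , z∈

  standardCycle-of-max : ∀ {m} → IsCycleMax m → standardCycle m ≡ cycleOf π m
  standardCycle-of-max isMax rewrite Equivalence.to T-≡ (IsCycleMax⇒isCycleMax isMax) = refl

  standardCycle-unique : ∀ m → Unique (standardCycle m)
  standardCycle-unique m with isCycleMax π m
  ... | true  = cycleOf-unique m
  ... | false = AllPairs.[]

  next-∈-standardCycle : ∀ {m z} → z ∈ standardCycle m → π ⟨$⟩ʳ z ∈ standardCycle m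
  next-∈-standardCycle {m} z∈ with isCycleMax π m
  ... | true = next-∈-cycleOf z∈

  standardCycle-disjoint : ∀ {m m′} → m ≢ m′ → Disjoint (standardCycle m) (standardCycle m′)
  standardCycle-disjoint m≢m′ (z∈ , z∈′) with ∈-standardCycle⁻ z∈ | ∈-standardCycle⁻ z∈′
  ... | m-isMax , z∈m | m′-isMax , z∈m′ = m≢m′ (≤-antisym
    (m′-isMax (∈-cycleOf-trans z∈m′ (∈-cycleOf-sym z∈m)))
    (m-isMax (∈-cycleOf-trans z∈m (∈-cycleOf-sym z∈m′))))

  cycleWord : List (Fin n)
  cycleWord = concatMap standardCycle (allFin n)

  theta≡map-cycleWord : theta π ≡ map oneBased cycleWord
  theta≡map-cycleWord = sym (trans (map-concatMap oneBased standardCycle (allFin n))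
    (concatMap-cong (λ m → if-float (map oneBased) (isCycleMax π m)) (allFin n)))

  cycleWord-unique : Unique cycleWord
  cycleWord-unique = concat⁺ (All-map⁺ (All.universal standardCycle-unique (allFin n)))
                             (AllPairs-map⁺ (AllPairs.map standardCycle-disjoint (allFin⁺ n)))

  ∈-cycleWord : ∀ x → x ∈ cycleWord
  ∈-cycleWord x with cycleMax-exists x
  ... | m , m-isMax , x∈ = ∈-concatMap⁺ standardCycle
    (lose (∈-allFin m) (subst (x ∈_) (sym (standardCycle-of-max m-isMax)) x∈))

  length-cycleWord : length cycleWord ≡ n
  length-cycleWord = length-unique-enumeration cycleWord-unique ∈-cycleWord

position-cases : ∀ {p c n} → p + suc c ≡ n → p ≡ 0 ⊎ c ℕ.≤ 1 → suc p ≡ 1 ⊎ suc p ≡ n ∸ 1 ⊎ suc p ≡ n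
position-cases     refl (inj₁ refl)       = inj₁ refl
position-cases {p} refl (inj₂ z≤n)        = inj₂ (inj₂ (+-comm 1 p))
position-cases {p} refl (inj₂ (s≤s z≤n)) = inj₂ (inj₁ (sym (trans (cong (_∸ 1) (+-suc p 1)) (+-comm p 1))))

module _ {n} (π : Permutation′ (suc n)) where

  private
    M : Fin (suc n)
    M = fromℕ n

  lowerCycles : List (Fin (suc n))
  lowerCycles = concatMap (standardCycle π) (tabulate inject₁)

  M-isCycleMax : IsCycleMax π M
  M-isCycleMax {z} _ = ≤fromℕ z

  cycleWord-split : cycleWord π ≡ lowerCycles ++ cycleOf π M
  cycleWord-split = begin
    concatMap (standardCycle π) (allFin (suc n))
      ≡⟨ cong (concatMap (standardCycle π)) (tabulate-∷ʳ id) ⟩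
    concatMap (standardCycle π) (tabulate inject₁ ++ M ∷ [])
      ≡⟨ concatMap-++ (standardCycle π) (tabulate inject₁) (M ∷ []) ⟩
    lowerCycles ++ standardCycle π M ++ []
      ≡⟨ cong (lowerCycles ++_) (++-identityʳ (standardCycle π M)) ⟩
    lowerCycles ++ standardCycle π M
      ≡⟨ cong (lowerCycles ++_) (standardCycle-of-max π M-isCycleMax) ⟩
    lowerCycles ++ cycleOf π M
      ∎
    where open ≡-Reasoning

  theta-split : theta π ≡ map oneBased (lowerCycles ++ cycleOf π M)
  theta-split = trans (theta≡map-cycleWord π) (cong (map oneBased) cycleWord-split)

  length-split : length lowerCycles + suc (length (cycleTail π M)) ≡ suc n
  length-split = trans (sym (length-++ lowerCycles)) (trans (cong length (sym cycleWord-split)) (length-cycleWord π))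

  lowerCycles-closed : ∀ {t} → t ∈ lowerCycles → π ⟨$⟩ʳ t ∈ lowerCycles
  lowerCycles-closed t∈ = ∈-concatMap⁺ (standardCycle π)
    (Any.map (next-∈-standardCycle π) (∈-concatMap⁻ (standardCycle π) {tabulate inject₁} t∈))

  lowerCycles-disjoint : Disjoint lowerCycles (cycleOf π M)
  lowerCycles-disjoint (t∈ , t∈M) with Any-tabulate⁻ (∈-concatMap⁻ (standardCycle π) {tabulate inject₁} t∈)
  ... | i , t∈i = standardCycle-disjoint π (fromℕ≢inject₁ ∘ sym)
    (t∈i , subst (_ ∈_) (sym (standardCycle-of-max π M-isCycleMax)) t∈M)

  lower<M : ∀ {t} → t ∈ lowerCycles → t < M
  lower<M {t} t∈ = ≤∧≢⇒< (≤fromℕ t) (λ t≡M → lowerCycles-disjoint (t∈ , here t≡M))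

  tail<M : ∀ {c} → c ∈ cycleTail π M → c < M
  tail<M {c} c∈ = ≤∧≢⇒< (≤fromℕ c) (λ c≡M → path-∌ π (cycleTail-path π M) (subst (_∈ _) c≡M c∈))

  tail<lower : Avoids132 (theta π) → ∀ {c p} → c ∈ cycleTail π M → p ∈ lowerCycles → c < p
  tail<lower avoids {c} {p} c∈ p∈ =
    ≤∧≢⇒< (≮⇒≥ p≮c) (λ c≡p → lowerCycles-disjoint (p∈ , there (subst (_∈ _) c≡p c∈)))
    where
    p≮c : ¬ p < c
    p≮c p<c = avoids (subst Contains132 (sym theta-split) (contains132-++ p∈ c∈ p<c (tail<M c∈)))

  long-tail-contains132 : ∀ {t c₁ c₂ cs} → t ∈ lowerCycles → Path π M (π ⟨$⟩ʳ M) (c₁ ∷ c₂ ∷ cs) →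
                          (∀ {c p} → c ∈ c₁ ∷ c₂ ∷ cs → p ∈ lowerCycles → c < p) →
                          Contains132 (oneLine π)
  long-tail-contains132 {t} t∈ path@(_ ∷ (c₂≢M ∷ _)) below with path-last-two π path
  ... | u , v , u∈ , v∈ , πu≡v , πv≡M with <-cmp v (π ⟨$⟩ʳ M)
  ... | tri< v<c₁ _ _ = oneLine-contains132 π (below u∈ t∈) (lower<M t∈)
    (subst (_< _) (sym πu≡v) v<c₁) (below (here refl) (lowerCycles-closed t∈))
  ... | tri≈ _ v≡c₁ _ = ⊥-elim (c₂≢M (subst (λ w → π ⟨$⟩ʳ w ≡ M) v≡c₁ πv≡M))
  ... | tri> _ _ c₁<v = oneLine-contains132 π c₁<v (below v∈ t∈)
    (below (there (here refl)) (lowerCycles-closed t∈)) (subst (_ <_) (sym πv≡M) (lower<M (lowerCycles-closed t∈)))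

  tail-short : Avoids132 (oneLine π) → Avoids132 (theta π) →
               ∀ {t} → t ∈ lowerCycles → length (cycleTail π M) ℕ.≤ 1
  tail-short avoids-π avoids-θ t∈ = go (cycleTail-path π M) (tail<lower avoids-θ)
    where
    go : ∀ {cs} → Path π M (π ⟨$⟩ʳ M) cs → (∀ {c p} → c ∈ cs → p ∈ lowerCycles → c < p) → length cs ℕ.≤ 1
    go {[]}        _    _     = z≤n
    go {_ ∷ []}    _    _     = s≤s z≤n
    go {_ ∷ _ ∷ _} path below = ⊥-elim (avoids-π (long-tail-contains132 t∈ path below))

  lower-empty-or-tail-short : Avoids132 (oneLine π) → Avoids132 (theta π) →
                              length lowerCycles ≡ 0 ⊎ length (cycleTail π M) ℕ.≤ 1
  lower-empty-or-tail-short avoids-π avoids-θ with lowerCycles | tail-short avoids-π avoids-θ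
  ... | []    | _     = inj₁ refl
  ... | _ ∷ _ | short = inj₂ (short (here refl))

  position-of-n : (i : Fin (length (theta π))) → lookup (theta π) i ≡ suc n → toℕ i ≡ length lowerCycles
  position-of-n i θᵢ≡n = trans
    (toℕ-lookup≡middle theta-split′ M∉lower M∉tail i (trans θᵢ≡n (cong suc (sym (toℕ-fromℕ n)))))
    (length-map oneBased lowerCycles)
    where
    theta-split′ : theta π ≡ map oneBased lowerCycles ++ oneBased M ∷ map oneBased (cycleTail π M)
    theta-split′ = trans theta-split (map-++ oneBased lowerCycles (cycleOf π M))
    M∉lower : oneBased M ∉ map oneBased lowerCycles
    M∉lower = oneBased-∉-map (λ M∈ → lowerCycles-disjoint (M∈ , here refl))
    M∉tail : oneBased M ∉ map oneBased (cycleTail π M)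
    M∉tail = oneBased-∉-map (path-∌ π (cycleTail-path π M))

lemma3p3 : ∀ (n : ℕ) (π : Permutation′ n) → Avoids132 (oneLine π) → Avoids132 (theta π)
           → ∀ (i : Fin (length (theta π))) → lookup (theta π) i ≡ n
           → suc (toℕ i) ≡ 1 ⊎ suc (toℕ i) ≡ n ∸ 1 ⊎ suc (toℕ i) ≡ n
lemma3p3 zero    π _        _        () _
lemma3p3 (suc n) π avoids-π avoids-θ i θᵢ≡n rewrite position-of-n π i θᵢ≡n =
  position-cases (length-split π) (lower-empty-or-tail-short π avoids-π avoids-θ)
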